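{- In every graph in $\Gamma\cup\Gamma'$ (in particular in each bicycle $BC_k$, $k\ge4$, in $\mathcal{W}_{13;1,5}$, and in each chain $Ch_k$, $k\ge 2$), every vertex of valency at least $3$ lies on a $4$-cycle. In particular, every graph in $\Gamma\cup\Gamma'$ other than the empty graph and $C_5$ contains a $4$-cycle.
   Context: All graphs are finite and simple; the empty graph is allowed. $BC_l$ ($l\ge 4$) has vertices $d_1,\dots,d_{2l}$, $e_1,\dots,e_l$ (indices mod $2l$, resp. mod $l$), edges $d_jd_{j+1}$, $e_ie_{i+1}$, $d_{2i-2}e_i$, $d_{2i+1}e_i$. $\mathcal{W}_{13;1,5}$ has vertex set $\mathbb{Z}/13\mathbb{Z}$, $x\sim y$ iff $x-y\in\{\pm1,\pm5\}$. Stitch: if $M\subseteq V(H)$ induces a connected bipartite subgraph with colour classes $M_1,M_2$, then $\mathrm{cr}(H;M)$ adds new vertices $a,x_1,x_2$ with edges $ax_1,ax_2$ and $x_j$ joined to all of $M_j$; $a$ is the apex. For a vertex $u$ with a neighbour in triangle-free $H$, $\mathrm{cr}(H;u)=\mathrm{cr}(H;B(u;1))$ with classes $\{u\}$ and the neighbours of $u$. $\mathrm{cr}^1=\mathrm{cr}$, $\mathrm{cr}^{j+1}(H;M)=\mathrm{cr}(\mathrm{cr}^j(H;M);a_j)$ with $a_j$ the $j$-th apex. Chains: $Ch_2=C_5$, $Ch_k=\mathrm{cr}^{k-2}(C_5;c)$ for $k\ge3$. Loop-chains: $\mathrm{cr}^j(BC_l;M)$, $l\ge4$, $j\ge1$,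 with $M$ a closed neighbourhood of a vertex, or $\{d_{2i-1},d_{2i},d_{2i+1},d_{2i+2}\}$, or $\{d_{2i},d_{2i+1},e_i,e_{i+1}\}$. $\Gamma$ is the class of graphs each of whose components is a bicycle or a copy of $\mathcal{W}_{13;1,5}$ (including the empty graph); $\Gamma'$ is the class of disjoint unions of one chain $Ch_k$ ($k\ge2$) or one loop-chain with a graph in $\Gamma$. -}

module Defs where

open import Data.Nat.Base using (ℕ; zero; suc; _+_; _*_; _∸_; _≤_; _<ᵇ_; _≡ᵇ_; _%_)
open import Data.Bool.Base using (Bool; true; false; _∧_; _∨_; not)
open import Data.Bool.Properties using (∨-comm; ∧-zeroʳ)
open import Data.Fin.Base using (Fin; zero; suc; toℕ; splitAt)
open import Data.Sum.Base using (_⊎_; inj₁; inj₂)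
open import Data.Product.Base using (Σ; ∃; _×_; _,_)
open import Data.List.Base using (List; []; _∷_; foldr; length; filterᵇ; allFin)
open import Data.List.Relation.Unary.All using (All)
open import Relation.Binary.PropositionalEquality using (_≡_; refl; _≢_; cong₂)
open import Relation.Nullary using (¬_)

record Graph : Set where
  field
    size       : ℕ
    adj        : Fin size → Fin size → Bool
    adj-sym    : ∀ u v → adj u v ≡ adj v u
    adj-irrefl : ∀ v → adj v v ≡ false
open Graph public

≡ᵇ-sym : ∀ m n → (m ≡ᵇ n) ≡ (n ≡ᵇ m)
≡ᵇ-sym zero zero = refl
≡ᵇ-sym zero (suc n) = refl
≡ᵇ-sym (suc m) zero = refl
≡ᵇ-sym (suc m) (suc n) = ≡ᵇ-sym m n

≡ᵇ-refl : ∀ n → (n ≡ᵇ n) ≡ true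
≡ᵇ-refl zero = refl
≡ᵇ-refl (suc n) = ≡ᵇ-refl n

mkGraph : (n : ℕ) → (Fin n → Fin n → Bool) → Graph
mkGraph n E = record
  { size = n
  ; adj = λ u v → (E u v ∨ E v u) ∧ not (toℕ u ≡ᵇ toℕ v)
  ; adj-sym = λ u v → cong₂ (λ a b → a ∧ not b) (∨-comm (E u v) (E v u)) (≡ᵇ-sym (toℕ u) (toℕ v))
  ; adj-irrefl = λ v → helper (E v v ∨ E v v) (toℕ v)
  }
  where
  helper : ∀ b k → b ∧ not (k ≡ᵇ k) ≡ false
  helper b k rewrite ≡ᵇ-refl k = ∧-zeroʳ b

-- a ≡ b (mod n)  (for n = 0: plain equality)
eqMod : ℕ → ℕ → ℕ → Bool
eqMod zero a b = a ≡ᵇ b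
eqMod (suc n) a b = (a % suc n) ≡ᵇ (b % suc n)

record _≅_ (G H : Graph) : Set where
  field
    to       : Fin (size G) → Fin (size H)
    from     : Fin (size H) → Fin (size G)
    from-to  : ∀ x → from (to x) ≡ x
    to-from  : ∀ y → to (from y) ≡ y
    adj-pres : ∀ u v → adj H (to u) (to v) ≡ adj G u v

deg : (G : Graph) → Fin (size G) → ℕ
deg G v = length (filterᵇ (adj G v) (allFin (size G)))

OnFourCycle : (G : Graph) → Fin (size G) → Set
OnFourCycle G v = Σ (Fin (size G)) λ a → Σ (Fin (size G)) λ b → Σ (Fin (size G)) λ c →
  (adj G v a ≡ true) × (adj G a b ≡ true) × (adj G b c ≡ true) × (adj G c v ≡ true) ×
  (v ≢ a) × (v ≢ b) × (v ≢ c) × (a ≢ b) × (a ≢ c) × (b ≢ c)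

HasFourCycle : Graph → Set
HasFourCycle G = Σ (Fin (size G)) λ v → OnFourCycle G v

emptyGraph : Graph
emptyGraph = mkGraph 0 (λ _ _ → false)

C5 : Graph
C5 = mkGraph 5 (λ x y → eqMod 5 (toℕ x + 1) (toℕ y))

-- W_{13;1,5}: x ~ y iff x - y ∈ {±1, ±5} (mod 13)
W13 : Graph
W13 = mkGraph 13 (λ x y → eqMod 13 (toℕ x + 1) (toℕ y) ∨ eqMod 13 (toℕ x + 5) (toℕ y))

-- Bicycle BC_l. Vertex d_j (j mod 2l) is numbered j mod 2l ∈ [0,2l),
-- vertex e_i (i mod l) is numbered 2l + (i mod l).
module BCIdx (l : ℕ) where
  isD : ℕ → Bool
  isD x = x <ᵇ (2 * l)
  dIs : ℕ → ℕ → Bool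
  dIs j x = isD x ∧ eqMod (2 * l) x j
  eIs : ℕ → ℕ → Bool
  eIs i x = not (isD x) ∧ eqMod l (x ∸ (2 * l)) i

  edge : ℕ → ℕ → Bool
  edge x y =
       (isD x ∧ dIs (x + 1) y)                                    -- d_j d_{j+1}
    ∨ (not (isD x) ∧ eIs (x ∸ (2 * l) + 1) y)                     -- e_i e_{i+1}
    ∨ (not (isD x) ∧ dIs (2 * (x ∸ (2 * l)) + 2 * l ∸ 2) y)       -- e_i d_{2i-2}
    ∨ (not (isD x) ∧ dIs (2 * (x ∸ (2 * l)) + 1) y)               -- e_i d_{2i+1}
open BCIdx public using (dIs; eIs)

BC : ℕ → Graph
BC l = mkGraph (3 * l) (λ x y → BCIdx.edge l (toℕ x) (toℕ y))

_⊕_ : Graph → Graph → Graph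
G ⊕ H = mkGraph (size G + size H) E
  where
  E : Fin (size G + size H) → Fin (size G + size H) → Bool
  E u v with splitAt (size G) u | splitAt (size G) v
  ... | inj₁ a | inj₁ b = adj G a b
  ... | inj₂ a | inj₂ b = adj H a b
  ... | _ | _ = false

⨁ : List Graph → Graph
⨁ = foldr _⊕_ emptyGraph

-- Stitch cr(H; M) with colour classes M₁, M₂ (given as Bool predicates).
-- New vertices: apex a = zero, x₁ = suc zero, x₂ = suc (suc zero);
-- the old vertex v becomes suc (suc (suc v)).

cr : (H : Graph) → (Fin (size H) → Bool) → (Fin (size H) → Bool) → Graph
cr H M₁ M₂ = mkGraph (3 + size H) E
  where
  E : Fin (3 + size H) → Fin (3 + size H) → Bool
  E zero (suc zero) = true
  E zero (suc (suc zero)) = true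
  E (suc zero) (suc (suc (suc v))) = M₁ v
  E (suc (suc zero)) (suc (suc (suc v))) = M₂ v
  E (suc (suc (suc u))) (suc (suc (suc v))) = adj H u v
  E _ _ = false

apex : (H : Graph) (M₁ M₂ : Fin (size H) → Bool) → Fin (size (cr H M₁ M₂))
apex H M₁ M₂ = zero

-- cr(H; u) = cr(H; B(u;1)) with classes {u} and N(u)
crAt : (H : Graph) → Fin (size H) → Graph
crAt H u = cr H (λ v → toℕ v ≡ᵇ toℕ u) (adj H u)

-- crPow j H M₁ M₂ = cr^(j+1)(H; M), paired with its last apex a_(j+1)
crPow : ℕ → (H : Graph) → (Fin (size H) → Bool) → (Fin (size H) → Bool) →
        Σ Graph (λ G → Fin (size G))
crPow zero H M₁ M₂ = cr H M₁ M₂ , zero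
crPow (suc j) H M₁ M₂ with crPow j H M₁ M₂
... | G , a = crAt G a , zero

crPowG : ℕ → (H : Graph) → (Fin (size H) → Bool) → (Fin (size H) → Bool) → Graph
crPowG j H M₁ M₂ with crPow j H M₁ M₂
... | G , _ = G

-- Chains Ch_k (k ≥ 2): Ch_2 = C₅, Ch_(j+3) = cr^(j+1)(C₅; c), c = vertex 0.

Ch : ℕ → Graph
Ch (suc (suc (suc j))) = crPowG j C5 (λ v → toℕ v ≡ᵇ 0) (adj C5 zero)
Ch _ = C5   -- k = 2 (k = 0, 1 are not used)

IsChain : Graph → Set
IsChain X = Σ ℕ λ k → (2 ≤ k) × (X ≅ Ch k)

-- The admissible stitch sets M (with colour classes) in BC_l
data LoopSet (l : ℕ) : (Fin (size (BC l)) → Bool) → (Fin (size (BC l)) → Bool) → Set where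
  ball : (u : Fin (size (BC l))) →
         LoopSet l (λ v → toℕ v ≡ᵇ toℕ u) (adj (BC l) u)
  -- {d_{2i-1}, d_{2i}, d_{2i+1}, d_{2i+2}}, classes {d_{2i-1}, d_{2i+1}}, {d_{2i}, d_{2i+2}}
  dpath : (i : ℕ) →
          LoopSet l (λ v → dIs l (2 * i + 2 * l ∸ 1) (toℕ v) ∨ dIs l (2 * i + 1) (toℕ v))
                    (λ v → dIs l (2 * i) (toℕ v) ∨ dIs l (2 * i + 2) (toℕ v))
  -- {d_{2i}, d_{2i+1}, e_i, e_{i+1}}, classes {d_{2i}, e_i}, {d_{2i+1}, e_{i+1}}
  square : (i : ℕ) →
           LoopSet l (λ v → dIs l (2 * i) (toℕ v) ∨ eIs l i (toℕ v))
                     (λ v → dIs l (2 * i + 1) (toℕ v) ∨ eIs l (i + 1) (toℕ v))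

-- Loop-chains cr^j(BC_l; M), l ≥ 4, j ≥ 1 (here j = m + 1)
IsLoopChain : Graph → Set
IsLoopChain X = Σ ℕ λ l → (4 ≤ l) × Σ ℕ λ m →
  Σ (Fin (size (BC l)) → Bool) λ M₁ → Σ (Fin (size (BC l)) → Bool) λ M₂ →
  LoopSet l M₁ M₂ × (X ≅ crPowG m (BC l) M₁ M₂)

IsBicycle : Graph → Set
IsBicycle H = Σ ℕ λ l → (4 ≤ l) × (H ≅ BC l)

InΓ : Graph → Set
InΓ G = Σ (List Graph) λ Hs → All (λ H → IsBicycle H ⊎ (H ≅ W13)) Hs × (G ≅ ⨁ Hs)

InΓ' : Graph → Set
InΓ' G = Σ Graph λ X → Σ Graph λ Y →
  (IsChain X ⊎ IsLoopChain X) × InΓ Y × (G ≅ (X ⊕ Y))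

module Submission where

-- Call a graph good when every vertex with three distinct neighbours lies on
-- a 4-cycle.  Goodness and the existence of a 4-cycle transfer along induced
-- embeddings, hence along isomorphisms and through disjoint unions.  The
-- stitch cr(H; M) keeps H as an induced subgraph, its apex a has exactly the
-- two neighbours x₁, x₂, and stitching at a vertex a with exactly two
-- neighbours p, q creates the square a p x₂ q through every new vertex of
-- valency ≥ 3 and through the three vertices whose neighbourhood changed.
-- So "the apex has two neighbours and every other vertex is good" is
-- invariant under iterated stitching at the apex.  It holds for C₅ (all
-- valencies are 2), and after the first stitch of a bicycle, because every
-- vertex of BC_l lies on a square d_{2i} d_{2i+1} e_i e_{i+1} and each
-- admissible set M places x₁ and x₂ on a 4-cycle.  W_{13;1,5} is checked by
-- computation.

open import Defs
open import Data.Nat.Base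
  using (ℕ; zero; suc; _+_; _*_; _∸_; _≤_; _<_; _<ᵇ_; _≡ᵇ_; _%_; _/_; z≤n; s≤s; NonZero; >-nonZero)
open import Data.Nat.Properties
  using (≡ᵇ⇒≡; ≡⇒≡ᵇ; <⇒<ᵇ; <ᵇ⇒<; <⇒≱; ≤-trans; <-≤-trans; m≤m+n; m≤n+m; m+n∸m≡n; m∸n+n≡m;
         +-monoʳ-<; +-cancelˡ-≡; +-cancelˡ-<; m+n≮m; m+[n∸m]≡n; +-∸-assoc; +-comm; +-assoc; ≮⇒≥; _<?_)
  renaming (_≟_ to _≟ℕ_)
open import Data.Nat.DivMod
  using (m%n<n; m%n%n≡m%n; [m+n]%n≡m%n; [m+kn]%n≡m%n; m<n⇒m%n≡m; %-distribˡ-+; m≡m%n+[m/n]*n)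
open import Data.Nat.Divisibility using (divides; ∣⇒≤)
open import Data.Nat.Tactic.RingSolver using (solve-∀)
open import Data.Bool.Base using (Bool; true; false; _∧_; _∨_; not; T)
open import Data.Bool.Properties using (T?; ∨-comm; ∨-identityʳ; ∧-identityʳ) renaming (_≟_ to _≟ᵇ_)
open import Data.Fin.Base using (Fin; zero; suc; toℕ; fromℕ<; splitAt; _↑ˡ_; _↑ʳ_)
open import Data.Fin.Properties
  using (toℕ-injective; toℕ-fromℕ<; toℕ<n; _≟_; all?; splitAt-↑ˡ; splitAt-↑ʳ; splitAt⁻¹-↑ˡ; splitAt⁻¹-↑ʳ;
         toℕ-↑ˡ; toℕ-↑ʳ; ↑ˡ-injective; ↑ʳ-injective)
  renaming (suc-injective to fsuc-injective)
open import Data.Sum.Base using (_⊎_; inj₁; inj₂; [_,_])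
open import Data.Product.Base using (Σ; _×_; _,_; proj₁; proj₂)
open import Data.List.Base using (List; []; _∷_; length; filterᵇ; allFin)
open import Data.List.Relation.Unary.All using (All; []; _∷_)
import Data.List.Relation.Unary.All as All
open import Data.List.Relation.Unary.Any using (here; there)
open import Data.List.Relation.Unary.AllPairs using (_∷_)
open import Data.List.Membership.Propositional using (_∈_)
open import Data.List.Membership.Propositional.Properties using (∈-filter⁻)
open import Data.List.Relation.Unary.Unique.Propositional using (Unique)
open import Data.List.Relation.Unary.Unique.Propositional.Properties using (allFin⁺; filter⁺)
open import Data.Unit.Base using (tt)
open import Data.Empty using (⊥; ⊥-elim)
open import Function.Base using (_∘_)
open import Relation.Binary.PropositionalEquality
  using (_≡_; refl; sym; trans; cong; cong₂; subst; subst₂; _≢_; ≢-sym)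
open import Relation.Nullary using (¬_; yes; no; Dec)
open import Relation.Nullary.Decidable using (True; toWitness; map′; _×-dec_; _⊎-dec_; _→-dec_; ¬?)
open import Relation.Unary using (Pred; Decidable)

true≢false : true ≢ false
true≢false ()

T⇒≡true : ∀ {b} → T b → b ≡ true
T⇒≡true {true} _ = refl

≡true⇒T : ∀ {b} → b ≡ true → T b
≡true⇒T refl = tt

≡ᵇ-true⇒≡ : ∀ m n → (m ≡ᵇ n) ≡ true → m ≡ n
≡ᵇ-true⇒≡ m n e = ≡ᵇ⇒≡ m n (≡true⇒T e)

≡⇒≡ᵇ-true : ∀ m n → m ≡ n → (m ≡ᵇ n) ≡ true
≡⇒≡ᵇ-true m n e = T⇒≡true (≡⇒≡ᵇ m n e)

≢⇒≡ᵇ-false : ∀ m n → m ≢ n → (m ≡ᵇ n) ≡ false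
≢⇒≡ᵇ-false m n m≢n with m ≡ᵇ n in eq
... | true = ⊥-elim (m≢n (≡ᵇ-true⇒≡ m n eq))
... | false = refl

<ᵇ-false : ∀ x y → ¬ (x < y) → (x <ᵇ y) ≡ false
<ᵇ-false x y x≮y with x <ᵇ y in eq
... | true = ⊥-elim (x≮y (<ᵇ⇒< x y (≡true⇒T eq)))
... | false = refl

<ᵇ-true : ∀ {x y} → x < y → (x <ᵇ y) ≡ true
<ᵇ-true x<y = T⇒≡true (<⇒<ᵇ x<y)

∨-introˡ : ∀ {a} b → a ≡ true → a ∨ b ≡ true
∨-introˡ b refl = refl

∨-introʳ : ∀ a {b} → b ≡ true → a ∨ b ≡ true
∨-introʳ true _ = refl
∨-introʳ false e = e

-- The shape of an adjacency produced by mkGraph from a relation that is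
-- symmetric on the pair and holds only between distinct vertices.
or-self-distinct : ∀ b c → (b ≡ true → c ≡ false) → (b ∨ b) ∧ not c ≡ b
or-self-distinct true c f rewrite f refl = refl
or-self-distinct false c f = refl

decideAll : ∀ {n p} {P : Pred (Fin n) p} (P? : Decidable P) → {True (all? P?)} → ∀ i → P i
decideAll P? {t} = toWitness t

adj⇒≢ : (G : Graph) {u v : Fin (size G)} → adj G u v ≡ true → u ≢ v
adj⇒≢ G {u} e refl = true≢false (trans (sym e) (adj-irrefl G u))

adj-symᵗ : (G : Graph) {u v : Fin (size G)} → adj G u v ≡ true → adj G v u ≡ true
adj-symᵗ G {u} {v} e = trans (adj-sym G v u) e

ThreeNeighbours : (G : Graph) → Fin (size G) → Set
ThreeNeighbours G v = Σ (Fin (size G)) λ a → Σ (Fin (size G)) λ b → Σ (Fin (size G)) λ c →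
  (adj G v a ≡ true) × (adj G v b ≡ true) × (adj G v c ≡ true) × (a ≢ b) × (a ≢ c) × (b ≢ c)

-- The property of the theorem, with "valency ≥ 3" read as three distinct neighbours.
Good : Graph → Set
Good G = ∀ v → ThreeNeighbours G v → OnFourCycle G v

two-neighbours : (G : Graph) (v p q : Fin (size G)) →
  (∀ w → adj G v w ≡ true → w ≡ p ⊎ w ≡ q) → ¬ ThreeNeighbours G v
two-neighbours G v p q only (a , b , c , va , vb , vc , a≢b , a≢c , b≢c)
  with only a va | only b vb | only c vc
... | inj₁ refl | inj₁ refl | _ = a≢b refl
... | inj₂ refl | inj₂ refl | _ = a≢b refl
... | inj₁ refl | _ | inj₁ refl = a≢c refl
... | inj₂ refl | _ | inj₂ refl = a≢c refl
... | _ | inj₁ refl | inj₁ refl = b≢c refl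
... | _ | inj₂ refl | inj₂ refl = b≢c refl

three-distinct : ∀ {A : Set} (P : A → Set) (xs : List A) → (∀ x → x ∈ xs → P x) → Unique xs →
  3 ≤ length xs → Σ A λ a → Σ A λ b → Σ A λ c → P a × P b × P c × a ≢ b × a ≢ c × b ≢ c
three-distinct P [] _ _ ()
three-distinct P (_ ∷ []) _ _ (s≤s ())
three-distinct P (_ ∷ _ ∷ []) _ _ (s≤s (s≤s ()))
three-distinct P (a ∷ b ∷ c ∷ _) inP ((a≢b ∷ a≢c ∷ _) ∷ (b≢c ∷ _) ∷ _) _ =
  a , b , c , inP a (here refl) , inP b (there (here refl)) , inP c (there (there (here refl))) ,
  a≢b , a≢c , b≢c

-- The neighbours counted by deg are distinct, so valency ≥ 3 gives three distinct neighbours.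
deg≥3⇒three : (G : Graph) (v : Fin (size G)) → 3 ≤ deg G v → ThreeNeighbours G v
deg≥3⇒three G v d≥3 =
  three-distinct (λ w → adj G v w ≡ true) (filterᵇ (adj G v) (allFin (size G))) isNeighbour
    (filter⁺ (T? ∘ adj G v) (allFin⁺ (size G))) d≥3
  where
  isNeighbour : ∀ w → w ∈ filterᵇ (adj G v) (allFin (size G)) → adj G v w ≡ true
  isNeighbour w w∈ = T⇒≡true (proj₂ (∈-filter⁻ (T? ∘ adj G v) {xs = allFin (size G)} w∈))

-- A 4-cycle a b c d; the edges force a ≢ b, b ≢ c, c ≢ d, d ≢ a.
record Square (G : Graph) (a b c d : Fin (size G)) : Set where
  constructor square
  field
    ab : adj G a b ≡ true
    bc : adj G b c ≡ true
    cd : adj G c d ≡ true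
    da : adj G d a ≡ true
    a≢c : a ≢ c
    b≢d : b ≢ d

square⇒on : ∀ {G a b c d} → Square G a b c d → OnFourCycle G a
square⇒on {G} {b = b} {c} {d} (square ab bc cd da a≢c b≢d) =
  b , c , d , ab , bc , cd , da ,
  adj⇒≢ G ab , a≢c , ≢-sym (adj⇒≢ G da) , adj⇒≢ G bc , b≢d , adj⇒≢ G cd

on⇒square : (G : Graph) {v : Fin (size G)} → OnFourCycle G v →
  Σ (Fin (size G)) λ a → Σ (Fin (size G)) λ b → Σ (Fin (size G)) λ c → Square G v a b c
on⇒square G (a , b , c , va , ab , bc , cv , _ , v≢b , _ , _ , a≢c , _) =
  a , b , c , square va ab bc cv v≢b a≢c

rotate : ∀ {G a b c d} → Square G a b c d → Square G b c d a
rotate (square ab bc cd da a≢c b≢d) = square bc cd da ab b≢d (≢-sym a≢c)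

reflect : ∀ {G a b c d} → Square G a b c d → Square G a d c b
reflect {G} (square ab bc cd da a≢c b≢d) =
  square (adj-symᵗ G da) (adj-symᵗ G cd) (adj-symᵗ G bc) (adj-symᵗ G ab) a≢c (≢-sym b≢d)

-- Being a square is decidable, which lets concrete squares be found by evaluation.
square? : (G : Graph) (a b c d : Fin (size G)) → Dec (Square G a b c d)
square? G a b c d =
  map′ (λ (ab , bc , cd , da , a≢c , b≢d) → square ab bc cd da a≢c b≢d)
       (λ (square ab bc cd da a≢c b≢d) → ab , bc , cd , da , a≢c , b≢d)
       ((adj G a b ≟ᵇ true) ×-dec (adj G b c ≟ᵇ true) ×-dec (adj G c d ≟ᵇ true) ×-dec
        (adj G d a ≟ᵇ true) ×-dec ¬? (a ≟ c) ×-dec ¬? (b ≟ d))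

record Embedding (G H : Graph) : Set where
  field
    embed     : Fin (size G) → Fin (size H)
    injective : ∀ {u v} → embed u ≡ embed v → u ≡ v
    adj-embed : ∀ u v → adj H (embed u) (embed v) ≡ adj G u v

module _ {G H : Graph} (e : Embedding G H) where
  open Embedding e

  embed-≢ : ∀ {u v} → u ≢ v → embed u ≢ embed v
  embed-≢ u≢v eq = u≢v (injective eq)

  embed-on : ∀ v → OnFourCycle G v → OnFourCycle H (embed v)
  embed-on v on with on⇒square G on
  ... | a , b , c , square va ab bc cv v≢b a≢c =
    square⇒on {H} (square (trans (adj-embed v a) va) (trans (adj-embed a b) ab) (trans (adj-embed b c) bc)
                      (trans (adj-embed c v) cv) (embed-≢ v≢b) (embed-≢ a≢c))

  embed-has : HasFourCycle G → HasFourCycle H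
  embed-has (v , on) = embed v , embed-on v on

  embed-three : ∀ v → ThreeNeighbours G v → ThreeNeighbours H (embed v)
  embed-three v (a , b , c , va , vb , vc , a≢b , a≢c , b≢c) =
    embed a , embed b , embed c , trans (adj-embed v a) va , trans (adj-embed v b) vb ,
    trans (adj-embed v c) vc , embed-≢ a≢b , embed-≢ a≢c , embed-≢ b≢c

  NeighboursEmbedded : Fin (size G) → Set
  NeighboursEmbedded v = ∀ w → adj H (embed v) w ≡ true → Σ (Fin (size G)) λ u → w ≡ embed u

  embed-good-at : Good G → ∀ v → NeighboursEmbedded v → ThreeNeighbours H (embed v) → OnFourCycle H (embed v)
  embed-good-at good v closed (x , y , z , vx , vy , vz , x≢y , x≢z , y≢z)
    with closed x vx | closed y vy | closed z vz
  ... | a , refl | b , refl | c , refl =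
    embed-on v (good v (a , b , c , trans (sym (adj-embed v a)) vx , trans (sym (adj-embed v b)) vy ,
                        trans (sym (adj-embed v c)) vz , (λ { refl → x≢y refl }) ,
                        (λ { refl → x≢z refl }) , (λ { refl → y≢z refl })))

module Iso {G H : Graph} (iso : G ≅ H) where
  open _≅_ iso

  forward : Embedding G H
  forward = record
    { embed = to
    ; injective = λ {x} {y} e → trans (sym (from-to x)) (trans (cong from e) (from-to y))
    ; adj-embed = adj-pres }

  backward : Embedding H G
  backward = record
    { embed = from
    ; injective = λ {x} {y} e → trans (sym (to-from x)) (trans (cong to e) (to-from y))
    ; adj-embed = λ x y → trans (sym (adj-pres (from x) (from y))) (cong₂ (adj H) (to-from x) (to-from y)) }

  good : Good H → Good G
  good goodH v three =
    subst (OnFourCycle G) (from-to v) (embed-on backward (to v) (goodH (to v) (embed-three forward v three)))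

  has : HasFourCycle H → HasFourCycle G
  has = embed-has backward

  empty : size H ≡ 0 → size G ≡ 0
  empty eq with size G | to
  ... | zero  | _ = refl
  ... | suc _ | t with subst Fin eq (t zero)
  ... | ()

≅-trans : {G H K : Graph} → G ≅ H → H ≅ K → G ≅ K
≅-trans I J = record
  { to = λ x → J.to (I.to x)
  ; from = λ y → I.from (J.from y)
  ; from-to = λ x → trans (cong I.from (J.from-to (I.to x))) (I.from-to x)
  ; to-from = λ y → trans (cong J.to (I.to-from (J.from y))) (J.to-from y)
  ; adj-pres = λ u v → trans (J.adj-pres (I.to u) (I.to v)) (I.adj-pres u v) }
  where
  module I = _≅_ I
  module J = _≅_ J

module Union (X Y : Graph) where
  private
    m = size X
    n = size Y

  adj-left : ∀ a b → adj (X ⊕ Y) (a ↑ˡ n) (b ↑ˡ n) ≡ adj X a b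
  adj-left a b rewrite splitAt-↑ˡ m a n | splitAt-↑ˡ m b n | adj-sym X b a | toℕ-↑ˡ a n | toℕ-↑ˡ b n =
    or-self-distinct (adj X a b) _ λ e → ≢⇒≡ᵇ-false _ _ (adj⇒≢ X e ∘ toℕ-injective)

  adj-right : ∀ a b → adj (X ⊕ Y) (m ↑ʳ a) (m ↑ʳ b) ≡ adj Y a b
  adj-right a b rewrite splitAt-↑ʳ m n a | splitAt-↑ʳ m n b | adj-sym Y b a | toℕ-↑ʳ m a | toℕ-↑ʳ m b =
    or-self-distinct (adj Y a b) _ λ e → ≢⇒≡ᵇ-false _ _ (adj⇒≢ Y e ∘ toℕ-injective ∘ +-cancelˡ-≡ m _ _)

  adj-across : ∀ a b → adj (X ⊕ Y) (a ↑ˡ n) (m ↑ʳ b) ≡ false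
  adj-across a b rewrite splitAt-↑ˡ m a n | splitAt-↑ʳ m n b = refl

  left : Embedding X (X ⊕ Y)
  left = record { embed = _↑ˡ n ; injective = ↑ˡ-injective n _ _ ; adj-embed = adj-left }

  right : Embedding Y (X ⊕ Y)
  right = record { embed = m ↑ʳ_ ; injective = ↑ʳ-injective m _ _ ; adj-embed = adj-right }

  side : ∀ w → (Σ (Fin m) λ b → w ≡ b ↑ˡ n) ⊎ (Σ (Fin n) λ b → w ≡ m ↑ʳ b)
  side w with splitAt m w in eq
  ... | inj₁ b = inj₁ (b , sym (splitAt⁻¹-↑ˡ eq))
  ... | inj₂ b = inj₂ (b , sym (splitAt⁻¹-↑ʳ eq))

  closed-left : ∀ a → NeighboursEmbedded left a
  closed-left a w aw with side w
  ... | inj₁ (b , refl) = b , refl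
  ... | inj₂ (b , refl) = ⊥-elim (true≢false (trans (sym aw) (adj-across a b)))

  closed-right : ∀ a → NeighboursEmbedded right a
  closed-right a w aw with side w
  ... | inj₂ (b , refl) = b , refl
  ... | inj₁ (b , refl) =
    ⊥-elim (true≢false (trans (sym aw) (trans (adj-sym (X ⊕ Y) (m ↑ʳ a) (b ↑ˡ n)) (adj-across b a))))

  -- every vertex of the union has its neighbourhood inside its own summand
  good : Good X → Good Y → Good (X ⊕ Y)
  good goodX goodY w with side w
  ... | inj₁ (a , refl) = embed-good-at left goodX a (closed-left a)
  ... | inj₂ (a , refl) = embed-good-at right goodY a (closed-right a)

  empty-right : size Y ≡ 0 → (X ⊕ Y) ≅ X
  empty-right eq = record
    { to = to ; from = _↑ˡ n ; from-to = from-to ; to-from = to-from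
    ; adj-pres = λ u v → trans (sym (adj-left (to u) (to v))) (cong₂ (adj (X ⊕ Y)) (from-to u) (from-to v)) }
    where
    noVertex : Fin n → ⊥
    noVertex b with subst Fin eq b
    ... | ()
    to : Fin (m + n) → Fin m
    to w with splitAt m w
    ... | inj₁ a = a
    ... | inj₂ b = ⊥-elim (noVertex b)
    from-to : ∀ w → to w ↑ˡ n ≡ w
    from-to w with splitAt m w in eq'
    ... | inj₁ a = splitAt⁻¹-↑ˡ eq'
    ... | inj₂ b = ⊥-elim (noVertex b)
    to-from : ∀ a → to (a ↑ˡ n) ≡ a
    to-from a rewrite splitAt-↑ˡ m a n = refl

good-⨁ : ∀ Hs → All Good Hs → Good (⨁ Hs)
good-⨁ [] [] ()
good-⨁ (H ∷ Hs) (g ∷ gs) = Union.good H (⨁ Hs) g (good-⨁ Hs gs)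

old : ∀ {n} → Fin n → Fin (3 + n)
old v = suc (suc (suc v))

module Stitch (H : Graph) (M₁ M₂ : Fin (size H) → Bool) where
  G : Graph
  G = cr H M₁ M₂

  x₁ x₂ : Fin (size G)
  x₁ = suc zero
  x₂ = suc (suc zero)

  adj-old : ∀ u v → adj G (old u) (old v) ≡ adj H u v
  adj-old u v rewrite adj-sym H v u =
    or-self-distinct (adj H u v) _ λ e → ≢⇒≡ᵇ-false _ _ (adj⇒≢ H e ∘ toℕ-injective)

  adj-x₁ : ∀ v → adj G x₁ (old v) ≡ M₁ v
  adj-x₁ v = trans (∧-identityʳ _) (∨-identityʳ (M₁ v))

  adj-x₂ : ∀ v → adj G x₂ (old v) ≡ M₂ v
  adj-x₂ v = trans (∧-identityʳ _) (∨-identityʳ (M₂ v))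

  inclusion : Embedding H G
  inclusion = record
    { embed = old
    ; injective = fsuc-injective ∘ fsuc-injective ∘ fsuc-injective
    ; adj-embed = adj-old }

  closed-old : ∀ v → M₁ v ≡ false → M₂ v ≡ false → NeighboursEmbedded inclusion v
  closed-old v m₁ m₂ zero ()
  closed-old v m₁ m₂ (suc zero) e =
    ⊥-elim (true≢false (trans (sym e) (trans (adj-sym G (old v) x₁) (trans (adj-x₁ v) m₁))))
  closed-old v m₁ m₂ (suc (suc zero)) e =
    ⊥-elim (true≢false (trans (sym e) (trans (adj-sym G (old v) x₂) (trans (adj-x₂ v) m₂))))
  closed-old v m₁ m₂ (suc (suc (suc u))) e = u , refl

  apex-neighbours : ∀ w → adj G zero w ≡ true → w ≡ x₁ ⊎ w ≡ x₂
  apex-neighbours zero ()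
  apex-neighbours (suc zero) _ = inj₁ refl
  apex-neighbours (suc (suc zero)) _ = inj₂ refl
  apex-neighbours (suc (suc (suc w))) ()

  x₁-two-neighbours : ∀ u → (∀ w → M₁ w ≡ true → w ≡ u) → ¬ ThreeNeighbours G x₁
  x₁-two-neighbours u single = two-neighbours G x₁ zero (old u) neighbours
    where
    neighbours : ∀ w → adj G x₁ w ≡ true → w ≡ zero ⊎ w ≡ old u
    neighbours zero _ = inj₁ refl
    neighbours (suc zero) ()
    neighbours (suc (suc zero)) ()
    neighbours (suc (suc (suc w))) e = inj₂ (cong old (single w (trans (sym (adj-x₁ w)) e)))

  square-x₁ : ∀ {a b c} → M₁ a ≡ true → adj H a b ≡ true → adj H b c ≡ true → M₁ c ≡ true →
              a ≢ c → OnFourCycle G x₁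
  square-x₁ {a} {b} {c} m₁a ab bc m₁c a≢c = square⇒on {G} {x₁} {old a} {old b} {old c}
    (square (trans (adj-x₁ a) m₁a) (trans (adj-old a b) ab) (trans (adj-old b c) bc)
            (trans (adj-sym G (old c) x₁) (trans (adj-x₁ c) m₁c)) (λ ()) (embed-≢ inclusion a≢c))

  square-x₂ : ∀ {a b c} → M₂ a ≡ true → adj H a b ≡ true → adj H b c ≡ true → M₂ c ≡ true →
              a ≢ c → OnFourCycle G x₂
  square-x₂ {a} {b} {c} m₂a ab bc m₂c a≢c = square⇒on {G} {x₂} {old a} {old b} {old c}
    (square (trans (adj-x₂ a) m₂a) (trans (adj-old a b) ab) (trans (adj-old b c) bc)
            (trans (adj-sym G (old c) x₂) (trans (adj-x₂ c) m₂c)) (λ ()) (embed-≢ inclusion a≢c))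

record ApexInvariant (G : Graph) (a : Fin (size G)) : Set where
  field
    p q       : Fin (size G)
    p≢q       : p ≢ q
    ap        : adj G a p ≡ true
    aq        : adj G a q ≡ true
    only      : ∀ w → adj G a w ≡ true → w ≡ p ⊎ w ≡ q
    good-else : ∀ v → v ≢ a → ThreeNeighbours G v → OnFourCycle G v

invariant⇒good : ∀ {G a} → ApexInvariant G a → Good G
invariant⇒good {G} {a} I v three with v ≟ a
... | yes refl = ⊥-elim (two-neighbours G a p q only three) where open ApexInvariant I
... | no v≢a = ApexInvariant.good-else I v v≢a three

stitch-invariant : ∀ H M₁ M₂ →
  (∀ v → v ≢ zero → ThreeNeighbours (cr H M₁ M₂) v → OnFourCycle (cr H M₁ M₂) v) →
  ApexInvariant (cr H M₁ M₂) zero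
stitch-invariant H M₁ M₂ good-else = record
  { p = suc zero ; q = suc (suc zero) ; p≢q = λ () ; ap = refl ; aq = refl
  ; only = Stitch.apex-neighbours H M₁ M₂ ; good-else = good-else }

apex-square : ∀ G a {p q} → p ≢ q → adj G a p ≡ true → adj G a q ≡ true →
              Square (crAt G a) (old a) (old p) (suc (suc zero)) (old q)
apex-square G a {p} {q} p≢q ap aq =
  square (trans (adj-old a p) ap) (trans (adj-sym G' (old p) x₂) (trans (adj-x₂ p) ap))
         (trans (adj-x₂ q) aq) (trans (adj-old q a) (adj-symᵗ G aq)) (λ ()) (embed-≢ inclusion p≢q)
  where open Stitch G (λ v → toℕ v ≡ᵇ toℕ a) (adj G a) renaming (G to G')

-- Stitching at the apex preserves the invariant: x₂ and the old a, p, q lie on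
-- the apex square, x₁ has valency 2, and every other old vertex keeps its neighbourhood.
stitch-at-apex : ∀ G a → ApexInvariant G a → ApexInvariant (crAt G a) zero
stitch-at-apex G a I = stitch-invariant G M₁ (adj G a) good-new
  where
  open ApexInvariant I
  M₁ : Fin (size G) → Bool
  M₁ v = toℕ v ≡ᵇ toℕ a
  open Stitch G M₁ (adj G a) renaming (G to G')
  C : Square G' (old a) (old p) x₂ (old q)
  C = apex-square G a p≢q ap aq
  good-new : ∀ v → v ≢ zero → ThreeNeighbours G' v → OnFourCycle G' v
  good-new zero v≢0 _ = ⊥-elim (v≢0 refl)
  good-new (suc zero) _ three =
    ⊥-elim (x₁-two-neighbours a (λ w m → toℕ-injective (≡ᵇ-true⇒≡ _ _ m)) three)
  good-new (suc (suc zero)) _ _ = square⇒on (rotate (rotate C))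
  good-new (suc (suc (suc v))) _ three with v ≟ a
  ... | yes refl = square⇒on C
  ... | no v≢a with adj G a v in av
  ...   | true with only v av
  ...     | inj₁ refl = square⇒on (rotate C)
  ...     | inj₂ refl = square⇒on (rotate (reflect C))
  good-new (suc (suc (suc v))) _ three | no v≢a | false =
    embed-good-at inclusion (invariant⇒good I)
      v (closed-old v (≢⇒≡ᵇ-false _ _ (v≢a ∘ toℕ-injective)) av) three

module Iterate (H : Graph) (M₁ M₂ : Fin (size H) → Bool) where
  invariant-iter : ApexInvariant (cr H M₁ M₂) zero →
    ∀ j → ApexInvariant (proj₁ (crPow j H M₁ M₂)) (proj₂ (crPow j H M₁ M₂))
  invariant-iter I zero = I
  invariant-iter I (suc j) with crPow j H M₁ M₂ | invariant-iter I j
  ... | G , a | ih = stitch-at-apex G a ih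

  has-iter : HasFourCycle (cr H M₁ M₂) → ∀ j → HasFourCycle (proj₁ (crPow j H M₁ M₂))
  has-iter h zero = h
  has-iter h (suc j) with crPow j H M₁ M₂ | has-iter h j
  ... | G , a | ih = embed-has (Stitch.inclusion G _ _) ih

  crPowG≡ : ∀ j → crPowG j H M₁ M₂ ≡ proj₁ (crPow j H M₁ M₂)
  crPowG≡ j with crPow j H M₁ M₂
  ... | _ = refl

  good : ApexInvariant (cr H M₁ M₂) zero → ∀ j → Good (crPowG j H M₁ M₂)
  good I j = subst Good (sym (crPowG≡ j)) (invariant⇒good (invariant-iter I j))

  has : HasFourCycle (cr H M₁ M₂) → ∀ j → HasFourCycle (crPowG j H M₁ M₂)
  has h j = subst HasFourCycle (sym (crPowG≡ j)) (has-iter h j)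

shift : ∀ {n} .{{_ : NonZero n}} → Fin n → ℕ → Fin n
shift {n} v k = fromℕ< (m%n<n (toℕ v + k) n)

C5-neighbours : ∀ v w → adj C5 v w ≡ true → w ≡ shift v 1 ⊎ w ≡ shift v 4
C5-neighbours = decideAll λ v → all? λ w →
  (adj C5 v w ≟ᵇ true) →-dec ((w ≟ shift v 1) ⊎-dec (w ≟ shift v 4))

C5-invariant : ApexInvariant C5 zero
C5-invariant = record
  { p = shift zero 1 ; q = shift zero 4 ; p≢q = λ () ; ap = refl ; aq = refl
  ; only = C5-neighbours zero
  ; good-else = λ v _ three → ⊥-elim (two-neighbours C5 v _ _ (C5-neighbours v) three) }

-- Chains are good: C₅ has no vertex of valency 3, and its first stitch is at a vertex of valency 2.
good-Ch : ∀ k → Good (Ch k)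
good-Ch zero = invariant⇒good C5-invariant
good-Ch (suc zero) = invariant⇒good C5-invariant
good-Ch (suc (suc zero)) = invariant⇒good C5-invariant
good-Ch (suc (suc (suc j))) = Iterate.good C5 _ _ (stitch-at-apex C5 zero C5-invariant) j

-- Ch_k for k ≥ 3 contains the square created by its first stitch.
has-Ch : ∀ j → HasFourCycle (Ch (3 + j))
has-Ch j = Iterate.has C5 _ _ (old zero , square⇒on (apex-square C5 zero p≢q ap aq)) j
  where open ApexInvariant C5-invariant

on-W13 : ∀ v → OnFourCycle W13 v
on-W13 v = square⇒on (W13-square v)
  where
  W13-square : ∀ v → Square W13 v (shift v 1) (shift v 6) (shift v 5)
  W13-square = decideAll λ v → square? W13 v (shift v 1) (shift v 6) (shift v 5)

suc-mod : ∀ N .{{_ : NonZero N}} → 1 < N → ∀ j → (j % N + 1) % N ≡ (j + 1) % N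
suc-mod N 1<N j = trans (cong (λ t → (j % N + t) % N) (sym (m<n⇒m%n≡m 1<N))) (sym (%-distribˡ-+ j 1 N))

-- adding 0 < d < N changes the residue mod N (otherwise N would divide d)
shift-mod-≢ : ∀ N .{{_ : NonZero N}} a d → 0 < d → d < N → (a + d) % N ≢ a % N
shift-mod-≢ N a d 0<d d<N eq = <⇒≱ d<N (∣⇒≤ {{>-nonZero 0<d}} (divides (s / N) d≡qN))
  where
  r = a % N
  s = r + d
  s%N≡r : s % N ≡ r
  s%N≡r = trans (cong (λ t → (r + t) % N) (sym (m<n⇒m%n≡m d<N))) (trans (sym (%-distribˡ-+ a d N)) eq)
  d≡qN : d ≡ s / N * N
  d≡qN = +-cancelˡ-≡ r d _ (trans (m≡m%n+[m/n]*n s N) (cong (_+ s / N * N) s%N≡r))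

halve : ∀ j → Σ ℕ λ i → (j ≡ 2 * i) ⊎ (j ≡ 2 * i + 1)
halve zero = 0 , inj₁ refl
halve (suc j) with halve j
... | i , inj₁ e = i , inj₂ (trans (cong suc e) (+-comm 1 (2 * i)))
... | i , inj₂ e = suc i , inj₁ (trans (cong suc e) (lemma i))
  where
  lemma : ∀ i → suc (2 * i + 1) ≡ 2 * suc i
  lemma = solve-∀

module Bicycle (k : ℕ) where
  l n : ℕ
  l = suc (suc k)
  n = 2 * l
  open BCIdx l using (isD; edge)

  1<n : 1 < n
  1<n = s≤s (s≤s z≤n)

  2<n : 2 < n
  2<n = s≤s (s≤s (≤-trans (s≤s z≤n) (m≤n+m _ k)))

  1<l : 1 < l
  1<l = s≤s (s≤s z≤n)

  3l≡n+l : 3 * l ≡ n + l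
  3l≡n+l = lemma l
    where
    lemma : ∀ l → 3 * l ≡ 2 * l + l
    lemma = solve-∀

  d-bound : ∀ j → j % n < 3 * l
  d-bound j = subst (j % n <_) (sym 3l≡n+l) (<-≤-trans (m%n<n j n) (m≤m+n n l))

  e-bound : ∀ i → n + i % l < 3 * l
  e-bound i = subst (n + i % l <_) (sym 3l≡n+l) (+-monoʳ-< n (m%n<n i l))

  D : ℕ → Fin (size (BC l))
  D j = fromℕ< (d-bound j)

  E : ℕ → Fin (size (BC l))
  E i = fromℕ< (e-bound i)

  toℕ-D : ∀ j → toℕ (D j) ≡ j % n
  toℕ-D j = toℕ-fromℕ< (d-bound j)

  toℕ-E : ∀ i → toℕ (E i) ≡ n + i % l
  toℕ-E i = toℕ-fromℕ< (e-bound i)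

  -- Adjacency of BC_l on vertex numbers; adj (BC l) u v is Adjℕ (toℕ u) (toℕ v).
  Adjℕ : ℕ → ℕ → Set
  Adjℕ x y = (edge x y ∨ edge y x) ∧ not (x ≡ᵇ y) ≡ true

  edge⇒Adjℕ : ∀ x y → edge x y ≡ true → x ≢ y → Adjℕ x y
  edge⇒Adjℕ x y e x≢y rewrite e | ≢⇒≡ᵇ-false x y x≢y = refl

  edge-dd : ∀ x y → isD x ≡ true → dIs l (x + 1) y ≡ true → edge x y ≡ true
  edge-dd x y d e rewrite d | e = refl

  edge-ee : ∀ x y → isD x ≡ false → eIs l (x ∸ n + 1) y ≡ true → edge x y ≡ true
  edge-ee x y d e rewrite d | e = refl

  edge-ed₂ : ∀ x y → isD x ≡ false → dIs l (2 * (x ∸ n) + n ∸ 2) y ≡ true → edge x y ≡ true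
  edge-ed₂ x y d e rewrite d | e | ∨-comm (eIs l (x ∸ n + 1) y) true = refl

  edge-ed₁ : ∀ x y → isD x ≡ false → dIs l (2 * (x ∸ n) + 1) y ≡ true → edge x y ≡ true
  edge-ed₁ x y d e rewrite d | e = or-true (eIs l (x ∸ n + 1) y) (dIs l (2 * (x ∸ n) + n ∸ 2) y)
    where
    or-true : ∀ a b → a ∨ b ∨ true ≡ true
    or-true true b = refl
    or-true false true = refl
    or-true false false = refl

  isD-D : ∀ j → isD (j % n) ≡ true
  isD-D j = <ᵇ-true (m%n<n j n)

  n+r≮n : ∀ r → ¬ (n + r < n)
  n+r≮n r = m+n≮m n r

  isD-E : ∀ r → isD (n + r) ≡ false
  isD-E r = <ᵇ-false _ n (n+r≮n r)

  dIs-true : ∀ j y → y < n → y % n ≡ j % n → dIs l j y ≡ true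
  dIs-true j y y<n e = cong₂ _∧_ (<ᵇ-true y<n) (≡⇒≡ᵇ-true _ _ e)

  eIs-true : ∀ i y → ¬ (y < n) → (y ∸ n) % l ≡ i % l → eIs l i y ≡ true
  eIs-true i y y≮n e = cong₂ _∧_ (cong not (<ᵇ-false y n y≮n)) (≡⇒≡ᵇ-true _ _ e)

  d≢e : ∀ j r → j % n ≢ n + r
  d≢e j r e = n+r≮n r (subst (_< n) e (m%n<n j n))

  double-mod : ∀ i c → (2 * (i % l) + c) % n ≡ (2 * i + c) % n
  double-mod i c = sym (trans (cong (λ t → (2 * t + c) % n) (m≡m%n+[m/n]*n i l))
                   (trans (cong (_% n) (lemma (i % l) (i / l) c l)) ([m+kn]%n≡m%n (2 * (i % l) + c) (i / l) n)))
    where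
    lemma : ∀ r q c l → 2 * (r + q * l) + c ≡ (2 * r + c) + q * (2 * l)
    lemma = solve-∀

  Adj-dd : ∀ j j' → (j + 1) % n ≡ j' % n → Adjℕ (j % n) (j' % n)
  Adj-dd j j' e = edge⇒Adjℕ _ _
    (edge-dd (j % n) (j' % n) (isD-D j)
      (dIs-true (j % n + 1) (j' % n) (m%n<n j' n) (trans (m%n%n≡m%n j' n) (trans (sym e) (sym (suc-mod n 1<n j))))))
    (λ t → shift-mod-≢ n j 1 (s≤s z≤n) 1<n (trans e (sym t)))

  Adj-ed₁ : ∀ i → Adjℕ (n + i % l) ((2 * i + 1) % n)
  Adj-ed₁ i = edge⇒Adjℕ _ _
    (edge-ed₁ (n + i % l) ((2 * i + 1) % n) (isD-E (i % l))
      (dIs-true (2 * (n + i % l ∸ n) + 1) ((2 * i + 1) % n) (m%n<n (2 * i + 1) n) (trans (m%n%n≡m%n (2 * i + 1) n)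
        (trans (sym (double-mod i 1)) (cong (λ t → (2 * t + 1) % n) (sym (m+n∸m≡n n (i % l))))))))
    (λ t → d≢e (2 * i + 1) (i % l) (sym t))

  Adj-ee : ∀ i → Adjℕ (n + i % l) (n + (i + 1) % l)
  Adj-ee i = edge⇒Adjℕ _ _
    (edge-ee (n + i % l) (n + (i + 1) % l) (isD-E (i % l))
      (eIs-true (n + i % l ∸ n + 1) (n + (i + 1) % l) (n+r≮n ((i + 1) % l)) (trans (cong (_% l) (m+n∸m≡n n ((i + 1) % l)))
        (trans (m%n%n≡m%n (i + 1) l)
          (trans (sym (suc-mod l 1<l i)) (cong (λ t → (t + 1) % l) (sym (m+n∸m≡n n (i % l)))))))))
    (λ t → shift-mod-≢ l i 1 (s≤s z≤n) 1<l (sym (+-cancelˡ-≡ n _ _ t)))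

  Adj-ed₂ : ∀ i → Adjℕ (n + (i + 1) % l) ((2 * i) % n)
  Adj-ed₂ i = edge⇒Adjℕ _ _
    (edge-ed₂ (n + r) ((2 * i) % n) (isD-E r)
      (dIs-true (2 * (n + r ∸ n) + n ∸ 2) ((2 * i) % n) (m%n<n (2 * i) n) (trans (m%n%n≡m%n (2 * i) n) (sym index))))
    (λ t → d≢e (2 * i) r (sym t))
    where
    r = (i + 1) % l
    2≤n : 2 ≤ n
    2≤n = s≤s (s≤s z≤n)
    lemma : ∀ i m → 2 * (i + 1) + m ≡ 2 * i + (2 + m)
    lemma = solve-∀
    index : (2 * (n + r ∸ n) + n ∸ 2) % n ≡ (2 * i) % n
    index = trans (cong (λ t → (2 * t + n ∸ 2) % n) (m+n∸m≡n n r))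
            (trans (cong (_% n) (+-∸-assoc (2 * r) 2≤n))
            (trans (double-mod (i + 1) (n ∸ 2))
            (trans (cong (_% n) (trans (lemma i (n ∸ 2)) (cong (2 * i +_) (m+[n∸m]≡n 2≤n))))
            ([m+n]%n≡m%n (2 * i) n))))

  D-is-d : ∀ j → dIs l j (toℕ (D j)) ≡ true
  D-is-d j = subst (λ y → dIs l j y ≡ true) (sym (toℕ-D j)) (dIs-true j (j % n) (m%n<n j n) (m%n%n≡m%n j n))

  E-is-e : ∀ i → eIs l i (toℕ (E i)) ≡ true
  E-is-e i = subst (λ y → eIs l i y ≡ true) (sym (toℕ-E i)) (
    eIs-true i (n + i % l) (n+r≮n (i % l)) (trans (cong (_% l) (m+n∸m≡n n (i % l))) (m%n%n≡m%n i l)))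

  adj-dd : ∀ j j' → (j + 1) % n ≡ j' % n → adj (BC l) (D j) (D j') ≡ true
  adj-dd j j' e = subst₂ Adjℕ (sym (toℕ-D j)) (sym (toℕ-D j')) (Adj-dd j j' e)

  D≢E : ∀ j i → D j ≢ E i
  D≢E j i e = d≢e j (i % l) (trans (sym (toℕ-D j)) (trans (cong toℕ e) (toℕ-E i)))

  D≢D : ∀ j j' d → 0 < d → d < n → (j + d) % n ≡ j' % n → D j ≢ D j'
  D≢D j j' d 0<d d<n e t =
    shift-mod-≢ n j d 0<d d<n (trans e (sym (trans (sym (toℕ-D j)) (trans (cong toℕ t) (toℕ-D j')))))

  block : ∀ i → Square (BC l) (D (2 * i)) (D (2 * i + 1)) (E i) (E (i + 1))
  block i = square
    (adj-dd (2 * i) (2 * i + 1) refl)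
    (adj-symᵗ (BC l) {E i} {D (2 * i + 1)} (subst₂ Adjℕ (sym (toℕ-E i)) (sym (toℕ-D (2 * i + 1))) (Adj-ed₁ i)))
    (subst₂ Adjℕ (sym (toℕ-E i)) (sym (toℕ-E (i + 1))) (Adj-ee i))
    (subst₂ Adjℕ (sym (toℕ-E (i + 1))) (sym (toℕ-D (2 * i))) (Adj-ed₂ i))
    (D≢E (2 * i) i) (D≢E (2 * i + 1) (i + 1))

  D-index : ∀ v j → toℕ v < n → toℕ v ≡ j → D j ≡ v
  D-index v j v<n e = toℕ-injective (trans (toℕ-D j) (trans (cong (_% n) (sym e)) (m<n⇒m%n≡m v<n)))

  -- Every vertex is d_{2i}, d_{2i+1} or e_i, so it lies on a block.
  on-BC : ∀ v → OnFourCycle (BC l) v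
  on-BC v with toℕ v <? n
  ... | yes v<n with halve (toℕ v)
  ...   | i , inj₁ e = subst (OnFourCycle (BC l)) (D-index v _ v<n e) (square⇒on (block i))
  ...   | i , inj₂ e = subst (OnFourCycle (BC l)) (D-index v _ v<n e) (square⇒on (rotate (block i)))
  on-BC v | no v≮n = subst (OnFourCycle (BC l)) isE (square⇒on (rotate (rotate (block i))))
    where
    i = toℕ v ∸ n
    i<l : i < l
    i<l = +-cancelˡ-< n i l (subst (_< n + l) (sym (m+[n∸m]≡n (≮⇒≥ v≮n))) (subst (toℕ v <_) 3l≡n+l (toℕ<n v)))
    isE : E i ≡ v
    isE = toℕ-injective (trans (toℕ-E i) (trans (cong (n +_) (m<n⇒m%n≡m i<l)) (m+[n∸m]≡n (≮⇒≥ v≮n))))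

module LoopChain (k : ℕ) where
  open Bicycle k

  -- d_{2i-1} is D (2i + n ∸ 1); these identify its successors.
  pred-suc : ∀ a → a + n ∸ 1 + 1 ≡ a + n
  pred-suc a = m∸n+n≡m (≤-trans (s≤s z≤n) (m≤n+m n a))

  pred-suc-suc : ∀ a → a + n ∸ 1 + 2 ≡ (a + 1) + n
  pred-suc-suc a = trans (sym (+-assoc (a + n ∸ 1) 1 1)) (trans (cong (_+ 1) (pred-suc a)) (lemma a n))
    where
    lemma : ∀ a n → a + n + 1 ≡ a + 1 + n
    lemma = solve-∀

  first-stitch : ∀ M₁ M₂ → LoopSet l M₁ M₂ → ApexInvariant (cr (BC l) M₁ M₂) zero
  first-stitch M₁ M₂ M = stitch-invariant (BC l) M₁ M₂ (good-new M)
    where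
    open Stitch (BC l) M₁ M₂
    good-new : LoopSet l M₁ M₂ → ∀ v → v ≢ zero → ThreeNeighbours G v → OnFourCycle G v
    good-new _ zero v≢0 _ = ⊥-elim (v≢0 refl)
    good-new _ (suc (suc (suc v))) _ _ = embed-on inclusion v (on-BC v)
    -- M = B(u; 1): x₁ has valency 2, and x₂ closes a path a u c through two neighbours of u.
    good-new (ball u) (suc zero) _ three =
      ⊥-elim (x₁-two-neighbours u (λ w m → toℕ-injective (≡ᵇ-true⇒≡ _ _ m)) three)
    good-new (ball u) (suc (suc zero)) _ _ with on⇒square (BC l) (on-BC u)
    ... | a , _ , c , square ua _ _ cu _ a≢c =
      square-x₂ ua (adj-symᵗ (BC l) {u} {a} ua) (adj-symᵗ (BC l) {c} {u} cu) (adj-symᵗ (BC l) {c} {u} cu) a≢c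
    -- M = {d_{2i-1}, d_{2i}, d_{2i+1}, d_{2i+2}}: paths d_{2i-1} d_{2i} d_{2i+1} and d_{2i} d_{2i+1} d_{2i+2}.
    good-new (dpath i) (suc zero) _ _ =
      square-x₁ (∨-introˡ _ (D-is-d (2 * i + n ∸ 1))) (adj-dd (2 * i + n ∸ 1) (2 * i) step₁)
                (adj-dd (2 * i) (2 * i + 1) refl) (∨-introʳ _ (D-is-d (2 * i + 1)))
                (D≢D (2 * i + n ∸ 1) (2 * i + 1) 2 (s≤s z≤n) 2<n step₂)
      where
      step₁ : (2 * i + n ∸ 1 + 1) % n ≡ (2 * i) % n
      step₁ = trans (cong (_% n) (pred-suc (2 * i))) ([m+n]%n≡m%n (2 * i) n)
      step₂ : (2 * i + n ∸ 1 + 2) % n ≡ (2 * i + 1) % n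
      step₂ = trans (cong (_% n) (pred-suc-suc (2 * i))) ([m+n]%n≡m%n (2 * i + 1) n)
    good-new (dpath i) (suc (suc zero)) _ _ =
      square-x₂ (∨-introˡ _ (D-is-d (2 * i))) (adj-dd (2 * i) (2 * i + 1) refl)
                (adj-dd (2 * i + 1) (2 * i + 2) step) (∨-introʳ _ (D-is-d (2 * i + 2)))
                (D≢D (2 * i) (2 * i + 2) 2 (s≤s z≤n) 2<n refl)
      where
      step : (2 * i + 1 + 1) % n ≡ (2 * i + 2) % n
      step = cong (_% n) (+-assoc (2 * i) 1 1)
    -- M = {d_{2i}, d_{2i+1}, e_i, e_{i+1}}: paths along the block d_{2i} d_{2i+1} e_i e_{i+1}.
    good-new (square i) (suc zero) _ _ =
      square-x₁ (∨-introˡ _ (D-is-d (2 * i))) ab bc (∨-introʳ _ (E-is-e i)) a≢c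
      where open Square (block i)
    good-new (square i) (suc (suc zero)) _ _ =
      square-x₂ (∨-introˡ _ (D-is-d (2 * i + 1))) (adj-symᵗ (BC l) {D (2 * i)} {D (2 * i + 1)} ab)
                (adj-symᵗ (BC l) {E (i + 1)} {D (2 * i)} da)
                (∨-introʳ _ (E-is-e (i + 1))) b≢d
      where open Square (block i)

has-BC : ∀ k → HasFourCycle (BC (2 + k))
has-BC k = Bicycle.D k 0 , Bicycle.on-BC k (Bicycle.D k 0)

good-component : ∀ {H} → IsBicycle H ⊎ (H ≅ W13) → Good H
good-component (inj₁ (suc (suc k) , s≤s (s≤s _) , iso)) = Iso.good iso (λ v _ → Bicycle.on-BC k v)
good-component (inj₂ iso) = Iso.good iso (λ v _ → on-W13 v)

has-component : ∀ {H} → IsBicycle H ⊎ (H ≅ W13) → HasFourCycle H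
has-component (inj₁ (suc (suc k) , s≤s (s≤s _) , iso)) = Iso.has iso (has-BC k)
has-component (inj₂ iso) = Iso.has iso (zero , on-W13 zero)

good-Γ : ∀ {G} → InΓ G → Good G
good-Γ (Hs , components , iso) = Iso.good iso (good-⨁ Hs (All.map good-component components))

has-Γ : ∀ {G} → InΓ G → ¬ (size G ≡ 0) → HasFourCycle G
has-Γ ([] , [] , iso) nonempty = ⊥-elim (nonempty (Iso.empty iso refl))
has-Γ (H ∷ Hs , component ∷ _ , iso) _ = Iso.has iso (embed-has (Union.left H (⨁ Hs)) (has-component component))

good-loop-chain : ∀ {X} → IsLoopChain X → Good X
good-loop-chain (suc (suc k) , s≤s (s≤s _) , m , M₁ , M₂ , M , iso) =
  Iso.good iso (Iterate.good (BC (2 + k)) M₁ M₂ (LoopChain.first-stitch k M₁ M₂ M) m)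

has-loop-chain : ∀ {X} → IsLoopChain X → HasFourCycle X
has-loop-chain (suc (suc k) , s≤s (s≤s _) , m , M₁ , M₂ , _ , iso) =
  Iso.has iso (Iterate.has (BC (2 + k)) M₁ M₂ (embed-has (Stitch.inclusion (BC (2 + k)) M₁ M₂) (has-BC k)) m)

good-Γ' : ∀ {G} → InΓ' G → Good G
good-Γ' (X , Y , chain , rest , iso) = Iso.good iso (Union.good X Y (good-chain chain) (good-Γ rest))
  where
  good-chain : IsChain X ⊎ IsLoopChain X → Good X
  good-chain (inj₁ (k , _ , isoX)) = Iso.good isoX (good-Ch k)
  good-chain (inj₂ loop) = good-loop-chain loop

has-Γ' : ∀ {G} → InΓ' G → ¬ (G ≅ C5) → HasFourCycle G
has-Γ' (X , Y , chain , rest , iso) notC5 with size Y ≟ℕ 0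
... | no Y≢∅ = Iso.has iso (embed-has (Union.right X Y) (has-Γ rest Y≢∅))
... | yes Y≡∅ = Iso.has iso (embed-has (Union.left X Y) (has-chain chain))
  where
  has-chain : IsChain X ⊎ IsLoopChain X → HasFourCycle X
  has-chain (inj₂ loop) = has-loop-chain loop
  has-chain (inj₁ (suc (suc (suc j)) , _ , isoX)) = Iso.has isoX (has-Ch j)
  has-chain (inj₁ (suc zero , s≤s () , _))
  has-chain (inj₁ (suc (suc zero) , _ , isoX)) =
    ⊥-elim (notC5 (≅-trans iso (≅-trans (Union.empty-right X Y Y≡∅) isoX)))

lemma5p4 : (G : Graph) → InΓ G ⊎ InΓ' G →
    ((v : Fin (size G)) → 3 ≤ deg G v → OnFourCycle G v)
    × (¬ (size G ≡ 0) → ¬ (G ≅ C5) → HasFourCycle G)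
lemma5p4 G member = (λ v d≥3 → good v (deg≥3⇒three G v d≥3)) , has
  where
  good : Good G
  good = [ good-Γ , good-Γ' ] member
  has : ¬ (size G ≡ 0) → ¬ (G ≅ C5) → HasFourCycle G
  has nonempty notC5 = [ (λ g → has-Γ g nonempty) , (λ g → has-Γ' g notC5) ] member
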